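{- Let $\mathrm{P}\in\{\mathrm{cICK},\mathrm{cICKT},\mathrm{cICKS4},\mathrm{cICKS5}\}$ and let $\sigma$ be a sequent. If $\sigma$ has a cyclic proof in $\mathrm{P}$, then $\sigma$ is valid over the class of frames associated with $\mathrm{P}$ (all epistemic frames for $\mathrm{cICK}$, reflexive frames for $\mathrm{cICKT}$, S4 frames for $\mathrm{cICKS4}$, S5 frames for $\mathrm{cICKS5}$).
   Context: Formulae over a finite non-empty set $\mathsf{A}$ of agents and atoms $\mathrm{Prop}$: $\varphi ::= \bot \mid p \mid \varphi\wedge\varphi\mid\varphi\vee\varphi\mid\varphi\to\varphi\mid K_a\varphi\mid C\varphi$; $\neg\varphi:=\varphi\to\bot$. Semantics: an epistemic frame $(\mathcal{W},\leq,\{R_a\})$ has $\mathcal{W}\neq\emptyset$, $\leq$ a partial order, $R_a\subseteq\mathcal{W}^2$ with triangle confluence ($w\leq v$, $vR_au$ imply $wR_au$); reflexive/S4/S5 frames have each $R_a$ reflexive / reflexive and transitive / an equivalence relation. Models add a $\leq$-monotone valuation; $w\models\varphi\to\psi$ iff for all $v\geq w$, $v\models\varphi$ implies $v\models\psi$; $w\models K_a\varphi$ iff all $R_a$-successors satisfy $\varphi$; $w\models C\varphi$ iff all $R^*$-successors satisfy $\varphi$ ($R^*$ reflexive–transitive closure of $\bigcup_aR_a$); atoms, $\bot,\wedge,\vee$ as usual. Sequents: an annotated formula is $\varphi^x$ with $x\in\{\mathsf{u},\mathsf{f}\}$ (unfocused / in focus). For a set $\Gamma$ of annotated formulae, $\Gamma^-=\{\varphi:\varphi^x\in\Gamma\}$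 and $K_a\Gamma=\{(K_a\psi)^x:\psi^x\in\Gamma\}$. A sequent $\Gamma\Rightarrow\Delta$ consists of finite sets of annotated formulae such that all formulae in $\Gamma$ are unfocused, at most one formula of $\Delta$ is in focus, and a focused formula has the form $C\psi$ or $K_aC\psi$. It is valid over a class if $\bigwedge\Gamma^-\to\bigvee\Delta^-$ is (empty conjunction $\bot\to\bot$, empty disjunction $\bot$). Rules (premises $\Rightarrow$ conclusion; $\Gamma,\Delta,\Pi,\Sigma$ finite, possibly empty; $x\in\{\mathsf{u},\mathsf{f}\}$; premises and conclusion must be sequents): axioms id: $\Gamma,\varphi^{\mathsf{u}}\Rightarrow\varphi^x,\Delta$ and $\bot$: $\Gamma,\bot^{\mathsf{u}}\Rightarrow\Delta$; $\wedge$L: $\Gamma,\varphi^{\mathsf{u}},\psi^{\mathsf{u}}\Rightarrow\Delta$ / $\Gamma,(\varphi\wedge\psi)^{\mathsf{u}}\Rightarrow\Delta$; $\wedge$R: $\Gamma\Rightarrow\varphi^{\mathsf{u}},\Delta$ and $\Gamma\Rightarrow\psi^{\mathsf{u}},\Delta$ / $\Gamma\Rightarrow(\varphi\wedge\psi)^{\mathsf{u}},\Delta$; $\vee$L: $\Gamma,\varphi^{\mathsf{u}}\Rightarrow\Delta$ and $\Gamma,\psi^{\mathsf{u}}\Rightarrow\Delta$ / $\Gamma,(\varphi\vee\psi)^{\mathsf{u}}\Rightarrow\Delta$; $\vee$R: $\Gamma\Rightarrow\varphi^{\mathsf{u}},\psi^{\mathsf{u}},\Delta$ / $\Gamma\Rightarrow(\varphi\vee\psi)^{\mathsf{u}},\Delta$;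 $\to$L: $\Gamma\Rightarrow\varphi^{\mathsf{u}},\Delta$ and $\Gamma,\psi^{\mathsf{u}}\Rightarrow\Delta$ / $\Gamma,(\varphi\to\psi)^{\mathsf{u}}\Rightarrow\Delta$; $\to$R: $\Gamma,\varphi^{\mathsf{u}}\Rightarrow\psi^{\mathsf{u}}$ / $\Gamma\Rightarrow(\varphi\to\psi)^{\mathsf{u}},\Delta$; u: $\Gamma\Rightarrow\varphi^{\mathsf{u}},\Delta$ / $\Gamma\Rightarrow\varphi^{\mathsf{f}},\Delta$; f: $\Gamma\Rightarrow\varphi^{\mathsf{f}},\Delta$ / $\Gamma\Rightarrow\varphi^{\mathsf{u}},\Delta$; $\mathsf{K}_a$: $\Gamma\Rightarrow\varphi^x$ / $\Pi,K_a\Gamma\Rightarrow(K_a\varphi)^x,\Sigma$; $\mathsf{T}_a$: $\Gamma,\varphi^{\mathsf{u}}\Rightarrow\Delta$ / $\Gamma,(K_a\varphi)^{\mathsf{u}}\Rightarrow\Delta$; $\mathsf{S4}_a$: $K_a\Gamma\Rightarrow\varphi^x$ / $\Pi,K_a\Gamma\Rightarrow(K_a\varphi)^x,\Sigma$; $\mathsf{S5}_a$: $K_a\Gamma\Rightarrow\varphi^x,K_a\Delta$ / $\Pi,K_a\Gamma\Rightarrow(K_a\varphi)^x,K_a\Delta,\Sigma$; $\mathsf{K}_a{\to}$: $\Gamma,(K_a\varphi)^{\mathsf{u}}\Rightarrow\psi^{\mathsf{u}},\Delta$ / $\Gamma\Rightarrow(K_a\varphi\to\psi)^{\mathsf{u}},\Delta$;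 CL: $\Gamma,\varphi^{\mathsf{u}},\{(K_aC\varphi)^{\mathsf{u}}\}_{a\in\mathsf{A}}\Rightarrow\Delta$ / $\Gamma,(C\varphi)^{\mathsf{u}}\Rightarrow\Delta$; CR: $\Gamma\Rightarrow\varphi^{\mathsf{u}},\Delta$ and, for each $a\in\mathsf{A}$, $\Gamma\Rightarrow(K_aC\varphi)^x,\Delta$ / $\Gamma\Rightarrow(C\varphi)^x,\Delta$ (the distinguished $C\varphi$ is the principal formula); cut: $\Gamma,\varphi^{\mathsf{u}}\Rightarrow\Delta$ and $\Gamma\Rightarrow\varphi^{\mathsf{u}},\Delta$ / $\Gamma\Rightarrow\Delta$. Calculi: $\mathrm{cICK}$ = id, $\bot$, $\wedge$L/R, $\vee$L/R, $\to$L/R, u, f, $\mathsf{K}_a$ ($a\in\mathsf{A}$), CL, CR; $\mathrm{cICKT}$ = $\mathrm{cICK}$ plus $\mathsf{T}_a$; $\mathrm{cICKS4}$ = $\mathrm{cICKT}$ with $\mathsf{K}_a$ replaced by $\mathsf{S4}_a$; $\mathrm{cICKS5}$ = $\mathrm{cICKS4}$ with $\mathsf{S4}_a$ replaced by $\mathsf{S5}_a$, plus $\mathsf{K}_a{\to}$ and cut. A cyclic pre-proof of $\sigma$ is a finite tree labelled by sequents, root $\sigma$, each inner node with its children forming a rule instance. A path is successful if every sequent on it has a formula in focus and it passes through at least one CR instance whose principal formula is in focus. A repetition is a pair $(u,v)$ of distinct nodes with $v$ a descendant of $u$ and both labelled by the same sequent; it is successful if the path from $u$ to $v$ is. A cyclic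 proof is a cyclic pre-proof in which every leaf is an axiom instance (id or $\bot$) or there is a node $c$ with $(c,\text{leaf})$ a successful repetition. -}

module Defs where

open import Level using (0ℓ)
open import Data.Nat using (ℕ; suc)
open import Data.Fin using (Fin)
open import Data.Bool using (Bool; true; false)
open import Data.Unit using (⊤)
open import Data.Empty using (⊥)
open import Data.Product using (Σ; ∃; _×_; _,_; proj₁; proj₂)
open import Data.Sum using (_⊎_)
open import Data.List using (List; []; _∷_; _++_; map; allFin)
open import Data.List.Membership.Propositional using (_∈_)
open import Data.List.Relation.Unary.All using (All)
open import Data.List.Relation.Unary.Any using (Any)
open import Data.List.Relation.Binary.Pointwise using (Pointwise)
open import Relation.Binary.PropositionalEquality using (_≡_)
open import Relation.Binary.Definitions using (Reflexive; Transitive)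
open import Relation.Binary.Structures using (IsPartialOrder; IsEquivalence)
open import Relation.Binary.Construct.Closure.ReflexiveTransitive using (Star)

data Calculus : Set where
  cICK cICKT cICKS4 cICKS5 : Calculus

data HasK : Calculus → Set where
  k-ICK  : HasK cICK
  k-ICKT : HasK cICKT

data HasT : Calculus → Set where
  t-ICKT  : HasT cICKT
  t-ICKS4 : HasT cICKS4
  t-ICKS5 : HasT cICKS5

-- Annotations: unfocused / in focus
data Ann : Set where
  u f : Ann

module Logic (Atom : Set) (n : ℕ) where

  Agent : Set
  Agent = Fin (suc n)

  infixr 8 _∧'_
  infixr 7 _∨'_
  infixr 6 _⊃_

  data Form : Set where
    ⊥'    : Form
    atom  : Atom → Form
    _∧'_  : Form → Form → Form
    _∨'_  : Form → Form → Form
    _⊃_   : Form → Form → Form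
    K     : Agent → Form → Form
    C     : Form → Form

  ¬' : Form → Form
  ¬' φ = φ ⊃ ⊥'

  record Frame : Set₁ where
    field
      W        : Set
      inhabited : W
      _≤_      : W → W → Set
      isPO     : IsPartialOrder _≡_ _≤_
      R        : Agent → W → W → Set
      triangle : ∀ a {w v x} → w ≤ v → R a v x → R a w x

  AllFrames ReflexiveFrames S4Frames S5Frames : Frame → Set
  AllFrames F = ⊤
  ReflexiveFrames F = ∀ a → Reflexive (Frame.R F a)
  S4Frames F = ∀ a → Reflexive (Frame.R F a) × Transitive (Frame.R F a)
  S5Frames F = ∀ a → IsEquivalence (Frame.R F a)

  FrameClass : Calculus → Frame → Set
  FrameClass cICK   = AllFrames
  FrameClass cICKT  = ReflexiveFrames
  FrameClass cICKS4 = S4Frames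
  FrameClass cICKS5 = S5Frames

  Valuation : Frame → Set₁
  Valuation F = Atom → Frame.W F → Set

  Monotone : (F : Frame) → Valuation F → Set
  Monotone F V = ∀ p {w v} → Frame._≤_ F w v → V p w → V p v

  module Sat (F : Frame) (V : Valuation F) where
    open Frame F

    RA : W → W → Set
    RA w v = Σ Agent (λ a → R a w v)

    _⊨_ : W → Form → Set
    w ⊨ ⊥'       = ⊥
    w ⊨ atom p   = V p w
    w ⊨ (φ ∧' ψ) = (w ⊨ φ) × (w ⊨ ψ)
    w ⊨ (φ ∨' ψ) = (w ⊨ φ) ⊎ (w ⊨ ψ)
    w ⊨ (φ ⊃ ψ)  = ∀ v → w ≤ v → v ⊨ φ → v ⊨ ψ
    w ⊨ K a φ    = ∀ v → R a w v → v ⊨ φ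
    w ⊨ C φ      = ∀ v → Star RA w v → v ⊨ φ

  -- Sequents (sets of annotated formulae represented by lists;
  -- all notions below are invariant under set-equality _≋_)

  AForm : Set
  AForm = Form × Ann

  infix 3 _⇒_
  record Sequent : Set where
    constructor _⇒_
    field
      ant : List AForm
      succ : List AForm
  open Sequent public

  Kₗ : Agent → List AForm → List AForm
  Kₗ a = map (λ { (φ , x) → (K a φ , x) })

  strip : List AForm → List Form
  strip = map proj₁

  _≐_ : List AForm → List AForm → Set
  Γ ≐ Δ = (∀ {x} → x ∈ Γ → x ∈ Δ) × (∀ {x} → x ∈ Δ → x ∈ Γ)

  _≋_ : Sequent → Sequent → Set
  s ≋ t = (ant s ≐ ant t) × (succ s ≐ succ t)

  data Focusable : Form → Set where
    fC  : ∀ ψ → Focusable (C ψ)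
    fKC : ∀ a ψ → Focusable (K a (C ψ))

  WF : Sequent → Set
  WF s = (∀ {φ x} → (φ , x) ∈ ant s → x ≡ u)
       × (∀ {φ ψ} → (φ , f) ∈ succ s → (ψ , f) ∈ succ s → φ ≡ ψ)
       × (∀ {φ} → (φ , f) ∈ succ s → Focusable φ)

  HasFocus : Sequent → Set
  HasFocus s = ∃ λ φ → (φ , f) ∈ succ s

  ⋀ : List Form → Form
  ⋀ []           = ⊥' ⊃ ⊥'
  ⋀ (φ ∷ [])     = φ
  ⋀ (φ ∷ ψ ∷ Γ)  = φ ∧' ⋀ (ψ ∷ Γ)

  ⋁ : List Form → Form
  ⋁ []           = ⊥'
  ⋁ (φ ∷ [])     = φ
  ⋁ (φ ∷ ψ ∷ Γ)  = φ ∨' ⋁ (ψ ∷ Γ)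

  seqFormula : Sequent → Form
  seqFormula s = ⋀ (strip (ant s)) ⊃ ⋁ (strip (succ s))

  ValidOver : (Frame → Set) → Sequent → Set₁
  ValidOver Cls s = ∀ (F : Frame) → Cls F → (V : Valuation F) → Monotone F V →
                    ∀ (w : Frame.W F) → Sat._⊨_ F V w (seqFormula s)

  data Rule : Calculus → List Sequent → Sequent → Set where
    id   : ∀ {P} Γ φ x Δ → Rule P [] ((φ , u) ∷ Γ ⇒ (φ , x) ∷ Δ)
    botL : ∀ {P} Γ Δ → Rule P [] ((⊥' , u) ∷ Γ ⇒ Δ)
    ∧L   : ∀ {P} Γ φ ψ Δ →
           Rule P (((φ , u) ∷ (ψ , u) ∷ Γ ⇒ Δ) ∷ []) ((φ ∧' ψ , u) ∷ Γ ⇒ Δ)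
    ∧R   : ∀ {P} Γ φ ψ Δ →
           Rule P ((Γ ⇒ (φ , u) ∷ Δ) ∷ (Γ ⇒ (ψ , u) ∷ Δ) ∷ []) (Γ ⇒ (φ ∧' ψ , u) ∷ Δ)
    ∨L   : ∀ {P} Γ φ ψ Δ →
           Rule P (((φ , u) ∷ Γ ⇒ Δ) ∷ ((ψ , u) ∷ Γ ⇒ Δ) ∷ []) ((φ ∨' ψ , u) ∷ Γ ⇒ Δ)
    ∨R   : ∀ {P} Γ φ ψ Δ →
           Rule P ((Γ ⇒ (φ , u) ∷ (ψ , u) ∷ Δ) ∷ []) (Γ ⇒ (φ ∨' ψ , u) ∷ Δ)
    ⊃L   : ∀ {P} Γ φ ψ Δ →
           Rule P ((Γ ⇒ (φ , u) ∷ Δ) ∷ ((ψ , u) ∷ Γ ⇒ Δ) ∷ []) ((φ ⊃ ψ , u) ∷ Γ ⇒ Δ)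
    ⊃R   : ∀ {P} Γ φ ψ Δ →
           Rule P (((φ , u) ∷ Γ ⇒ (ψ , u) ∷ []) ∷ []) (Γ ⇒ (φ ⊃ ψ , u) ∷ Δ)
    uR   : ∀ {P} Γ φ Δ → Rule P ((Γ ⇒ (φ , u) ∷ Δ) ∷ []) (Γ ⇒ (φ , f) ∷ Δ)
    fR   : ∀ {P} Γ φ Δ → Rule P ((Γ ⇒ (φ , f) ∷ Δ) ∷ []) (Γ ⇒ (φ , u) ∷ Δ)
    Kr   : ∀ {P} → HasK P → ∀ a Γ φ x Π Σ' →
           Rule P ((Γ ⇒ (φ , x) ∷ []) ∷ []) (Π ++ Kₗ a Γ ⇒ (K a φ , x) ∷ Σ')
    Tr   : ∀ {P} → HasT P → ∀ a Γ φ Δ →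
           Rule P (((φ , u) ∷ Γ ⇒ Δ) ∷ []) ((K a φ , u) ∷ Γ ⇒ Δ)
    S4r  : ∀ {P} → P ≡ cICKS4 → ∀ a Γ φ x Π Σ' →
           Rule P ((Kₗ a Γ ⇒ (φ , x) ∷ []) ∷ []) (Π ++ Kₗ a Γ ⇒ (K a φ , x) ∷ Σ')
    S5r  : ∀ {P} → P ≡ cICKS5 → ∀ a Γ φ x Δ Π Σ' →
           Rule P ((Kₗ a Γ ⇒ (φ , x) ∷ Kₗ a Δ) ∷ [])
                  (Π ++ Kₗ a Γ ⇒ (K a φ , x) ∷ Kₗ a Δ ++ Σ')
    K⊃   : ∀ {P} → P ≡ cICKS5 → ∀ a Γ φ ψ Δ →
           Rule P (((K a φ , u) ∷ Γ ⇒ (ψ , u) ∷ Δ) ∷ []) (Γ ⇒ (K a φ ⊃ ψ , u) ∷ Δ)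
    CL   : ∀ {P} Γ φ Δ →
           Rule P (((φ , u) ∷ map (λ a → (K a (C φ) , u)) (allFin (suc n)) ++ Γ ⇒ Δ) ∷ [])
                  ((C φ , u) ∷ Γ ⇒ Δ)
    CR   : ∀ {P} Γ φ x Δ →
           Rule P ((Γ ⇒ (φ , u) ∷ Δ) ∷ map (λ a → Γ ⇒ (K a (C φ) , x) ∷ Δ) (allFin (suc n)))
                  (Γ ⇒ (C φ , x) ∷ Δ)
    cut  : ∀ {P} → P ≡ cICKS5 → ∀ Γ φ Δ →
           Rule P (((φ , u) ∷ Γ ⇒ Δ) ∷ (Γ ⇒ (φ , u) ∷ Δ) ∷ []) (Γ ⇒ Δ)

  focCRRule : ∀ {P ps s} → Rule P ps s → Bool
  focCRRule (CR _ _ f _) = true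
  focCRRule _            = false

  record Inst (P : Calculus) (ps : List Sequent) (s : Sequent) : Set where
    constructor inst
    field
      ps'  : List Sequent
      s'   : Sequent
      rule : Rule P ps' s'
      prem≋ : Pointwise _≋_ ps ps'
      conc≋ : s ≋ s'

  focCR : ∀ {P ps s} → Inst P ps s → Bool
  focCR i = focCRRule (Inst.rule i)

  -- finite trees: inner nodes carry their rule instance; 'bud' = leaf
  -- that is not closed by an axiom (must have a companion).
  -- Axiom leaves are nodes with a zero-premise instance and no children.
  data Tree (P : Calculus) : Set where
    bud  : Sequent → Tree P
    node : (s : Sequent) (ps : List Sequent) → Inst P ps s → List (Tree P) → Tree P

  label : ∀ {P} → Tree P → Sequent
  label (bud s)        = s
  label (node s _ _ _) = s

  -- ancestors: label of node and whether it is a focused-principal CR instance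
  Entry : Set
  Entry = Sequent × Bool

  -- anc lists the ancestors of a leaf, nearest first.  A companion c is an
  -- ancestor such that (c, leaf) is a successful repetition: same sequent,
  -- every sequent on the path from c to the leaf has a formula in focus, and
  -- the path passes through a CR instance whose principal formula is in focus.
  Companion : List Entry → Sequent → Set
  Companion anc s =
    Σ (List Entry) λ seg → Σ Entry λ c → Σ (List Entry) λ rest →
      (anc ≡ seg ++ c ∷ rest)
      × (proj₁ c ≋ s)
      × All (λ e → HasFocus (proj₁ e)) (c ∷ seg)
      × HasFocus s
      × Any (λ e → proj₂ e ≡ true) (c ∷ seg)

  data Cyc (P : Calculus) : List Entry → Tree P → Set where
    bud  : ∀ {anc s} → WF s → Companion anc s → Cyc P anc (bud s)
    node : ∀ {anc s ps cs} (i : Inst P ps s) → WF s →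
           map label cs ≡ ps →
           All (Cyc P ((s , focCR i) ∷ anc)) cs →
           Cyc P anc (node s ps i cs)

  CyclicProof : Calculus → Sequent → Set
  CyclicProof P σ = Σ (Tree P) λ t → (label t ≡ σ) × Cyc P [] t

-- A focused formula is read at an approximation level k: C φ as "φ holds
-- along every path of fewer than k agent steps", K a (C φ) accordingly, while
-- unfocused formulas keep their meaning.  Every rule is sound level by level,
-- and a focused CR instance even when its premises hold only one level lower.
-- By induction on the pre-proof, and inside it on the level, every node is
-- valid at every level: a bud inherits validity from its companion, which is
-- available at the bud's level because the successful path between them passes
-- a focused CR, so the companion was entered at a strictly higher level.  As
-- at most one formula is in focus and its approximants converge to it,
-- validity at all levels is validity.
module Submission where

open import Defs
open import Level using (0ℓ)
open import Data.Nat using (ℕ; zero; suc; _≤_; _<_; s≤s)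
open import Axiom.ExcludedMiddle using (ExcludedMiddle)

open import Data.Nat.Properties using (≤-refl; n≤1+n; <⇒≤; <-≤-trans)
open import Data.Nat.Induction using (<-rec)
open import Data.Bool using (Bool; true; false)
import Data.Fin as Fin
open import Data.Unit using (⊤; tt)
open import Data.Empty using (⊥-elim)
open import Data.Product using (_×_; _,_; proj₁; proj₂)
open import Data.Sum using (inj₁; inj₂)
open import Data.List using (List; []; _∷_; _++_; map; allFin)
open import Data.List.Membership.Propositional using (_∈_; find; lose)
open import Data.List.Relation.Unary.All using (All; []; _∷_)
import Data.List.Relation.Unary.All as All
import Data.List.Relation.Unary.All.Properties as All
open import Data.List.Relation.Unary.Any using (Any; here; there)
import Data.List.Relation.Unary.Any as Any
import Data.List.Relation.Unary.Any.Properties as Any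
open import Data.List.Relation.Binary.Pointwise using (All-resp-Pointwise)
open import Data.List.Relation.Binary.Subset.Propositional.Properties using (Any-resp-⊆; All-resp-⊇)
open import Relation.Binary.PropositionalEquality using (_≡_; refl; sym; trans; subst)
open import Relation.Binary.Definitions using (Transitive)
open import Relation.Binary.Structures using (IsPartialOrder; IsEquivalence)
open import Relation.Binary.Construct.Closure.ReflexiveTransitive using (ε; _◅_)
open import Relation.Nullary using (¬_; yes; no)
open import Function using (_∘_)

module Soundness (Atom : Set) (n : ℕ) where
  open Logic Atom n

  ≋-sym : ∀ {s t} → s ≋ t → t ≋ s
  ≋-sym ((Γ⊆Γ′ , Γ′⊆Γ) , (Δ⊆Δ′ , Δ′⊆Δ)) = (Γ′⊆Γ , Γ⊆Γ′) , (Δ′⊆Δ , Δ⊆Δ′)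

  WF-resp-≋ : ∀ {s t} → s ≋ t → WF s → WF t
  WF-resp-≋ ((_ , Γ′⊆Γ) , (_ , Δ′⊆Δ)) (unfocused , unique , focusable) =
    (λ m → unfocused (Γ′⊆Γ m)) ,
    (λ m m′ → unique (Δ′⊆Δ m) (Δ′⊆Δ m′)) ,
    (λ m → focusable (Δ′⊆Δ m))

  HasFocus-resp-≋ : ∀ {s t} → s ≋ t → HasFocus s → HasFocus t
  HasFocus-resp-≋ (_ , (Δ⊆Δ′ , _)) (φ , m) = φ , Δ⊆Δ′ m

  FocusUnique : List AForm → Set
  FocusUnique Δ = ∀ {φ ψ} → (φ , f) ∈ Δ → (ψ , f) ∈ Δ → φ ≡ ψ

  All-map-allFin⁻ : ∀ {A : Set} {Q : A → Set} {g : Agent → A} →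
                    All Q (map g (allFin (suc n))) → ∀ a → Q (g a)
  All-map-allFin⁻ qs = All.tabulate⁻ {f = λ a → a} (All.map⁻ qs)

  raise : Bool → ℕ → ℕ
  raise false j = j
  raise true  j = suc j

  ≤-raise : ∀ b j → j ≤ raise b j
  ≤-raise false j = ≤-refl
  ≤-raise true  j = n≤1+n j

  raise-mono : ∀ b {j k} → j ≤ k → raise b j ≤ raise b k
  raise-mono false j≤k = j≤k
  raise-mono true  j≤k = s≤s j≤k

  module Semantics (em : ExcludedMiddle 0ℓ) (F : Frame) (V : Valuation F) (mono : Monotone F V) where
    open Frame F renaming (_≤_ to _⊑_)
    open Sat F V

    ⊨-mono : ∀ φ {w v} → w ⊑ v → w ⊨ φ → v ⊨ φ
    ⊨-mono ⊥'       _   ()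
    ⊨-mono (atom p) w⊑v h = mono p w⊑v h
    ⊨-mono (φ ∧' ψ) w⊑v (hφ , hψ) = ⊨-mono φ w⊑v hφ , ⊨-mono ψ w⊑v hψ
    ⊨-mono (φ ∨' ψ) w⊑v (inj₁ hφ) = inj₁ (⊨-mono φ w⊑v hφ)
    ⊨-mono (φ ∨' ψ) w⊑v (inj₂ hψ) = inj₂ (⊨-mono ψ w⊑v hψ)
    ⊨-mono (φ ⊃ ψ)  w⊑v h = λ x v⊑x → h x (IsPartialOrder.trans isPO w⊑v v⊑x)
    ⊨-mono (K a φ)  w⊑v h = λ x r → h x (triangle a w⊑v r)
    ⊨-mono (C φ) {w} w⊑v h = λ where
      _ ε                → ⊨-mono φ w⊑v (h w ε)
      x ((a , r) ◅ path) → h x ((a , triangle a w⊑v r) ◅ path)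

    C-here : ∀ φ {w} → w ⊨ C φ → w ⊨ φ
    C-here φ h = h _ ε

    C-step : ∀ φ {w} → w ⊨ C φ → ∀ a → w ⊨ K a (C φ)
    C-step φ h a v r x path = h x ((a , r) ◅ path)

    C-fold : ∀ φ {w} → w ⊨ φ → (∀ a → w ⊨ K a (C φ)) → w ⊨ C φ
    C-fold φ hφ hK _ ε                = hφ
    C-fold φ hφ hK x ((a , r) ◅ path) = hK a _ r x path

    _⊨C[_]_ : W → ℕ → Form → Set
    w ⊨C[ zero  ] φ = ⊤
    w ⊨C[ suc k ] φ = w ⊨ φ × (∀ a v → R a w v → v ⊨C[ k ] φ)

    C⇒C[] : ∀ k φ {w} → w ⊨ C φ → w ⊨C[ k ] φ
    C⇒C[] zero    φ h = tt
    C⇒C[] (suc k) φ h = C-here φ h , λ a v r → C⇒C[] k φ (C-step φ h a v r)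

    C[]⇒C : ∀ φ {w} → (∀ k → w ⊨C[ k ] φ) → w ⊨ C φ
    C[]⇒C φ h _ ε                = proj₁ (h 1)
    C[]⇒C φ h x ((a , r) ◅ path) = C[]⇒C φ (λ k → proj₂ (h (suc k)) a _ r) x path

    _⊨⟨_⟩_ : W → ℕ → Form → Set
    w ⊨⟨ k ⟩ C φ   = w ⊨C[ k ] φ
    w ⊨⟨ k ⟩ K a φ = ∀ v → R a w v → v ⊨⟨ k ⟩ φ
    w ⊨⟨ k ⟩ φ     = w ⊨ φ

    ⊨⇒⊨⟨⟩ : ∀ k φ {w} → w ⊨ φ → w ⊨⟨ k ⟩ φ
    ⊨⇒⊨⟨⟩ k ⊥'       h = h
    ⊨⇒⊨⟨⟩ k (atom p) h = h
    ⊨⇒⊨⟨⟩ k (φ ∧' ψ) h = h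
    ⊨⇒⊨⟨⟩ k (φ ∨' ψ) h = h
    ⊨⇒⊨⟨⟩ k (φ ⊃ ψ)  h = h
    ⊨⇒⊨⟨⟩ k (K a φ)  h = λ v r → ⊨⇒⊨⟨⟩ k φ (h v r)
    ⊨⇒⊨⟨⟩ k (C φ)    h = C⇒C[] k φ h

    ⊨⟨⟩⇒⊨ : ∀ φ {w} → (∀ k → w ⊨⟨ k ⟩ φ) → w ⊨ φ
    ⊨⟨⟩⇒⊨ ⊥'       h = h 0
    ⊨⟨⟩⇒⊨ (atom p) h = h 0
    ⊨⟨⟩⇒⊨ (φ ∧' ψ) h = h 0
    ⊨⟨⟩⇒⊨ (φ ∨' ψ) h = h 0
    ⊨⟨⟩⇒⊨ (φ ⊃ ψ)  h = h 0
    ⊨⟨⟩⇒⊨ (K a φ)  h = λ v r → ⊨⟨⟩⇒⊨ φ (λ k → h k v r)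
    ⊨⟨⟩⇒⊨ (C φ)    h = C[]⇒C φ h

    _⊨[_]_ : W → ℕ → AForm → Set
    w ⊨[ k ] (φ , u) = w ⊨ φ
    w ⊨[ k ] (φ , f) = w ⊨⟨ k ⟩ φ

    ⊨⇒⊨[] : ∀ {k} x {φ w} → w ⊨ φ → w ⊨[ k ] (φ , x)
    ⊨⇒⊨[] u h = h
    ⊨⇒⊨[] f {φ} h = ⊨⇒⊨⟨⟩ _ φ h

    ⊨[]-K⁺ : ∀ {k a φ w} x → (∀ v → R a w v → v ⊨[ k ] (φ , x)) → w ⊨[ k ] (K a φ , x)
    ⊨[]-K⁺ u h = h
    ⊨[]-K⁺ f h = h

    ⊨[]-K⁻ : ∀ {k a φ w} x → w ⊨[ k ] (K a φ , x) → ∀ v → R a w v → v ⊨[ k ] (φ , x)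
    ⊨[]-K⁻ u h = h
    ⊨[]-K⁻ f h = h

    AllHold : W → List AForm → Set
    AllHold w Γ = All (λ d → w ⊨ proj₁ d) Γ

    AnyHolds : W → List AForm → Set
    AnyHolds w Δ = Any (λ d → w ⊨ proj₁ d) Δ

    AnyHoldsAt : ℕ → W → List AForm → Set
    AnyHoldsAt k w Δ = Any (λ d → w ⊨[ k ] d) Δ

    ValidAt : ℕ → Sequent → Set
    ValidAt k s = ∀ w → AllHold w (ant s) → AnyHoldsAt k w (succ s)

    ValidAt-resp-≋ : ∀ {k s t} → s ≋ t → ValidAt k s → ValidAt k t
    ValidAt-resp-≋ ((Γ⊆Γ′ , _) , (Δ⊆Δ′ , _)) valid w h =
      Any-resp-⊆ Δ⊆Δ′ (valid w (All-resp-⊇ Γ⊆Γ′ h))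

    AllHold-mono : ∀ {Γ w v} → w ⊑ v → AllHold w Γ → AllHold v Γ
    AllHold-mono w⊑v = All.map (λ {d} → ⊨-mono (proj₁ d) w⊑v)

    AllHold-Kₗ : ∀ {a Γ w v} → AllHold w (Kₗ a Γ) → R a w v → AllHold v Γ
    AllHold-Kₗ h r = All.map (λ hK → hK _ r) (All.map⁻ h)

    AllHold-Kₗ-trans : ∀ {a Γ w v} → Transitive (R a) → R a w v →
                       AllHold w (Kₗ a Γ) → AllHold v (Kₗ a Γ)
    AllHold-Kₗ-trans R-trans r h = All.map⁺ (All.map (λ hK z r′ → hK z (R-trans r r′)) (All.map⁻ h))

    AnyHoldsAt-Kₗ-euclid : ∀ {k a Δ w v} → IsEquivalence (R a) → R a w v →
                          AnyHoldsAt k v (Kₗ a Δ) → AnyHoldsAt k w (Kₗ a Δ)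
    AnyHoldsAt-Kₗ-euclid {k} {a} {w = w} {v} equiv r s = Any.map⁺ (Any.map (λ {d} → pull {d}) (Any.map⁻ s))
      where
        open IsEquivalence equiv renaming (sym to R-sym; trans to R-trans)
        pull : ∀ {d} → v ⊨[ k ] (K a (proj₁ d) , proj₂ d) → w ⊨[ k ] (K a (proj₁ d) , proj₂ d)
        pull {_ , x} hK = ⊨[]-K⁺ x (λ z r′ → ⊨[]-K⁻ x hK z (R-trans (R-sym r) r′))

    K-antitone : ∀ {a φ w v} → IsEquivalence (R a) → w ⊑ v → v ⊨ K a φ → w ⊨ K a φ
    K-antitone {a} equiv w⊑v hK z r = hK z (R-trans (R-sym (triangle a w⊑v R-refl)) r)
      where open IsEquivalence equiv renaming (refl to R-refl; sym to R-sym; trans to R-trans)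

    AnyHoldsAt-∷ : ∀ {k w d Δ} → (¬ AnyHoldsAt k w Δ → w ⊨[ k ] d) → AnyHoldsAt k w (d ∷ Δ)
    AnyHoldsAt-∷ {k} {w} {Δ = Δ} head with em {AnyHoldsAt k w Δ}
    ... | yes s = there s
    ... | no ¬s = here (head ¬s)

    AnyHoldsAt-head : ∀ {k w d Δ} → ¬ AnyHoldsAt k w Δ → AnyHoldsAt k w (d ∷ Δ) → w ⊨[ k ] d
    AnyHoldsAt-head ¬s (here h)  = h
    AnyHoldsAt-head ¬s (there s) = ⊥-elim (¬s s)

    AnyHoldsAt-unfocused : ∀ {j k w Δ} → (∀ {ψ} → ¬ (ψ , f) ∈ Δ) →
                           AnyHoldsAt j w Δ → AnyHoldsAt k w Δ
    AnyHoldsAt-unfocused unfocused s with find s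
    ... | (ψ , u) , m , h = lose m h
    ... | (ψ , f) , m , _ = ⊥-elim (unfocused m)

    -- Unfocused disjuncts do not depend on the level, and by uniqueness the
    -- focused disjunct is the same formula at every level.
    AnyHoldsAt-limit : ∀ {w Δ} → FocusUnique Δ → (∀ k → AnyHoldsAt k w Δ) → AnyHolds w Δ
    AnyHoldsAt-limit {w} {Δ} unique s with em {AnyHolds w Δ}
    ... | yes holds = holds
    ... | no ¬holds with find (s 0)
    ...   | (ψ , u) , m , h = lose m h
    ...   | (ψ , f) , m , _ = lose m (⊨⟨⟩⇒⊨ ψ at)
      where
        at : ∀ k → w ⊨⟨ k ⟩ ψ
        at k with find (s k)
        ... | (χ , u) , m′ , h = ⊥-elim (¬holds (lose m′ h))
        ... | (χ , f) , m′ , h = subst (w ⊨⟨ k ⟩_) (unique m′ m) h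

    -- Premises are needed one level lower exactly below a focused CR
    -- (b = true), and at every level when the conclusion has no focus.
    PremiseValidAt : Sequent → Bool → ℕ → Sequent → Set
    PremiseValidAt s b k p = ∀ j → (HasFocus s → raise b j ≡ k) → ValidAt j p

    PremisesValidAt : List Sequent → Sequent → Bool → ℕ → Set
    PremisesValidAt ps s b k = All (PremiseValidAt s b k) ps

    HasT⇒reflexive : ∀ {P} → HasT P → FrameClass P F → ∀ a {w} → R a w w
    HasT⇒reflexive t-ICKT  cls a = cls a
    HasT⇒reflexive t-ICKS4 cls a = proj₁ (cls a)
    HasT⇒reflexive t-ICKS5 cls a = IsEquivalence.refl (cls a)

    AnyHolds⇒AnyHoldsAt : ∀ {k w Δ} → AnyHolds w Δ → AnyHoldsAt k w Δ
    AnyHolds⇒AnyHoldsAt = Any.map (λ {d} → ⊨⇒⊨[] (proj₂ d))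

    fR-sound : ∀ {Γ φ Δ k} → WF (Γ ⇒ (φ , f) ∷ Δ) →
               PremiseValidAt (Γ ⇒ (φ , u) ∷ Δ) false k (Γ ⇒ (φ , f) ∷ Δ) →
               ValidAt k (Γ ⇒ (φ , u) ∷ Δ)
    fR-sound {Γ} {φ} {Δ} {k} (_ , unique , _) valid w h with em {(φ , f) ∈ Δ}
    ... | yes φᶠ∈Δ = refocus (valid k (λ _ → refl) w h)
      where
        refocus : AnyHoldsAt k w ((φ , f) ∷ Δ) → AnyHoldsAt k w ((φ , u) ∷ Δ)
        refocus (here hφ) = there (lose φᶠ∈Δ hφ)
        refocus (there s) = there s
    ... | no φᶠ∉Δ = unfocus (AnyHoldsAt-limit unique (λ j → valid j (⊥-elim ∘ no-focus) w h))
      where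
        no-focus : ¬ HasFocus (Γ ⇒ (φ , u) ∷ Δ)
        no-focus (ψ , there m) = φᶠ∉Δ (subst (λ χ → (χ , f) ∈ Δ) (unique (there m) (here refl)) m)
        unfocus : AnyHolds w ((φ , f) ∷ Δ) → AnyHoldsAt k w ((φ , u) ∷ Δ)
        unfocus (here hφ)  = here hφ
        unfocus (there hs) = there (AnyHolds⇒AnyHoldsAt hs)

    S5-sound : ∀ {a Γ φ x Δ Π Σ′ k} → IsEquivalence (R a) →
               ValidAt k (Kₗ a Γ ⇒ (φ , x) ∷ Kₗ a Δ) →
               ValidAt k (Π ++ Kₗ a Γ ⇒ (K a φ , x) ∷ Kₗ a Δ ++ Σ′)
    S5-sound {a} {x = x} {Δ = Δ} {Π = Π} {k = k} equiv valid w h with em {AnyHoldsAt k w (Kₗ a Δ)}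
    ... | yes s = there (Any.++⁺ˡ s)
    ... | no ¬s = here (⊨[]-K⁺ x λ v r →
            AnyHoldsAt-head (¬s ∘ AnyHoldsAt-Kₗ-euclid equiv r)
              (valid v (AllHold-Kₗ-trans (IsEquivalence.trans equiv) r (All.++⁻ʳ Π h))))

    K⊃-sound : ∀ {a Γ φ ψ Δ k} → IsEquivalence (R a) →
               ValidAt k ((K a φ , u) ∷ Γ ⇒ (ψ , u) ∷ Δ) →
               ValidAt k (Γ ⇒ (K a φ ⊃ ψ , u) ∷ Δ)
    K⊃-sound {a} {φ = φ} {ψ} equiv valid w h with em {w ⊨ K a φ}
    ... | no ¬hK = here (λ v w⊑v hK → ⊥-elim (¬hK (K-antitone {φ = φ} equiv w⊑v hK)))
    ... | yes hK with valid w (hK ∷ h)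
    ...   | here hψ = here (λ v w⊑v _ → ⊨-mono ψ w⊑v hψ)
    ...   | there s = there s

    -- The side formulas Δ carry no focus: by well-formedness of the
    -- conclusion it would be C φ, and of the first K premise K a (C φ).
    CRᶠ-sound : ∀ {Γ φ Δ k} → WF (Γ ⇒ (C φ , f) ∷ Δ) → WF (Γ ⇒ (K Fin.zero (C φ) , f) ∷ Δ) →
                ValidAt k (Γ ⇒ (φ , u) ∷ Δ) → (∀ a → ValidAt k (Γ ⇒ (K a (C φ) , f) ∷ Δ)) →
                ValidAt (suc k) (Γ ⇒ (C φ , f) ∷ Δ)
    CRᶠ-sound {Δ = Δ} (_ , unique , _) (_ , unique₀ , _) validφ validK w h =
      AnyHoldsAt-∷ λ ¬s → let ¬s′ = λ s → ¬s (AnyHoldsAt-unfocused unfocused s) in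
        AnyHoldsAt-head ¬s′ (validφ w h) , λ a → AnyHoldsAt-head ¬s′ (validK a w h)
      where
        unfocused : ∀ {ψ} → ¬ (ψ , f) ∈ Δ
        unfocused m with trans (unique (here refl) (there m)) (sym (unique₀ (here refl) (there m)))
        ... | ()

    rule-sound : ∀ {P ps s} → FrameClass P F → (r : Rule P ps s) → WF s → All WF ps →
                 ∀ k → PremisesValidAt ps s (focCRRule r) k → ValidAt k s
    rule-sound _ (id Γ φ x Δ) _ _ k _ w (hφ ∷ _) = here (⊨⇒⊨[] x hφ)
    rule-sound _ (botL Γ Δ) _ _ _ _ w (() ∷ _)
    rule-sound _ (∧L Γ φ ψ Δ) _ _ k (p ∷ []) w ((hφ , hψ) ∷ h) = p k (λ _ → refl) w (hφ ∷ hψ ∷ h)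
    rule-sound _ (∧R Γ φ ψ Δ) _ _ k (p ∷ q ∷ []) w h
      with p k (λ _ → refl) w h | q k (λ _ → refl) w h
    ... | there s  | _        = there s
    ... | here _   | there s  = there s
    ... | here hφ  | here hψ  = here (hφ , hψ)
    rule-sound _ (∨L Γ φ ψ Δ) _ _ k (p ∷ q ∷ []) w (inj₁ hφ ∷ h) = p k (λ _ → refl) w (hφ ∷ h)
    rule-sound _ (∨L Γ φ ψ Δ) _ _ k (p ∷ q ∷ []) w (inj₂ hψ ∷ h) = q k (λ _ → refl) w (hψ ∷ h)
    rule-sound _ (∨R Γ φ ψ Δ) _ _ k (p ∷ []) w h with p k (λ _ → refl) w h
    ... | here hφ         = here (inj₁ hφ)
    ... | there (here hψ) = here (inj₂ hψ)
    ... | there (there s) = there s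
    rule-sound _ (⊃L Γ φ ψ Δ) _ _ k (p ∷ q ∷ []) w (hφ⊃ψ ∷ h) with p k (λ _ → refl) w h
    ... | here hφ = q k (λ _ → refl) w (hφ⊃ψ w (IsPartialOrder.refl isPO) hφ ∷ h)
    ... | there s = s
    rule-sound _ (⊃R Γ φ ψ Δ) _ _ k (p ∷ []) w h =
      here λ v w⊑v hφ → Any.singleton⁻ (p k (λ _ → refl) v (hφ ∷ AllHold-mono w⊑v h))
    rule-sound _ (uR Γ φ Δ) _ _ k (p ∷ []) w h with p k (λ _ → refl) w h
    ... | here hφ = here (⊨⇒⊨⟨⟩ k φ hφ)
    ... | there s = there s
    rule-sound _ (fR Γ φ Δ) _ (wf ∷ []) k (p ∷ []) = fR-sound wf p
    rule-sound _ (Kr _ a Γ φ x Π Σ′) _ _ k (p ∷ []) w h =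
      here (⊨[]-K⁺ x λ v r → Any.singleton⁻ (p k (λ _ → refl) v (AllHold-Kₗ (All.++⁻ʳ Π h) r)))
    rule-sound cls (Tr t a Γ φ Δ) _ _ k (p ∷ []) w (hK ∷ h) =
      p k (λ _ → refl) w (hK w (HasT⇒reflexive t cls a) ∷ h)
    rule-sound cls (S4r refl a Γ φ x Π Σ′) _ _ k (p ∷ []) w h =
      here (⊨[]-K⁺ x λ v r →
        Any.singleton⁻ (p k (λ _ → refl) v (AllHold-Kₗ-trans (proj₂ (cls a)) r (All.++⁻ʳ Π h))))
    rule-sound cls (S5r refl a Γ φ x Δ Π Σ′) _ _ k (p ∷ []) = S5-sound (cls a) (p k (λ _ → refl))
    rule-sound cls (K⊃ refl a Γ φ ψ Δ) _ _ k (p ∷ []) = K⊃-sound (cls a) (p k (λ _ → refl))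
    rule-sound _ (CL Γ φ Δ) _ _ k (p ∷ []) w (hC ∷ h) =
      p k (λ _ → refl) w (C-here φ hC ∷ All.++⁺ (All.map⁺ (All.tabulate⁺ (C-step φ hC))) h)
    rule-sound _ (CR Γ φ u Δ) _ _ k (p ∷ ps) w h =
      AnyHoldsAt-∷ λ ¬s → C-fold φ (AnyHoldsAt-head ¬s (p k (λ _ → refl) w h))
                                   (λ a → AnyHoldsAt-head ¬s (All-map-allFin⁻ ps a k (λ _ → refl) w h))
    rule-sound _ (CR Γ φ f Δ) _ _ zero _ w h = here tt
    rule-sound _ (CR Γ φ f Δ) wf (_ ∷ wfs) (suc k) (p ∷ ps) =
      CRᶠ-sound wf (All-map-allFin⁻ wfs Fin.zero) (p k (λ _ → refl))
                (λ a → All-map-allFin⁻ ps a k (λ _ → refl))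
    rule-sound _ (cut refl Γ φ Δ) _ _ k (p ∷ q ∷ []) w h with q k (λ _ → refl) w h
    ... | here hφ = p k (λ _ → refl) w (hφ ∷ h)
    ... | there s = s

    inst-sound : ∀ {P ps s} → FrameClass P F → (i : Inst P ps s) → WF s → All WF ps →
                 ∀ k → PremisesValidAt ps s (focCR i) k → ValidAt k s
    inst-sound cls (inst ps′ s′ r ps≋ps′ s≋s′) wf wfs k valid =
      ValidAt-resp-≋ (≋-sym s≋s′)
        (rule-sound cls r (WF-resp-≋ s≋s′ wf) (All-resp-Pointwise WF-resp-≋ ps≋ps′ wfs) k
          (All-resp-Pointwise (λ p≋p′ vp j lvl → ValidAt-resp-≋ p≋p′ (vp j lvl)) ps≋ps′
            (All.map (λ vp j lvl → vp j (lvl ∘ HasFocus-resp-≋ s≋s′)) valid)))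

    ValidBelow : ℕ → Sequent → Set
    ValidBelow k s = ∀ {i} → i < k → ValidAt i s

    -- The invariant for a node at level j: an ancestor joined to it by a path
    -- of focused sequents is valid below j + the number of focused CR
    -- instances on that path.
    AncestorsValid : ℕ → List Entry → Set
    AncestorsValid j []              = ⊤
    AncestorsValid j ((s , b) ∷ anc) = HasFocus s → ValidBelow (raise b j) s × AncestorsValid (raise b j) anc

    AncestorsValid-mono : ∀ {j k} anc → j ≤ k → AncestorsValid k anc → AncestorsValid j anc
    AncestorsValid-mono []              j≤k _ = tt
    AncestorsValid-mono ((s , b) ∷ anc) j≤k H hf =
      (λ lt → proj₁ (H hf) (<-≤-trans lt (raise-mono b j≤k))) ,
      AncestorsValid-mono anc (raise-mono b j≤k) (proj₂ (H hf))

    AncestorsValid-∷ : ∀ {s b anc j k} → (HasFocus s → raise b j ≡ k) →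
                       ValidBelow k s → AncestorsValid k anc → AncestorsValid j ((s , b) ∷ anc)
    AncestorsValid-∷ lvl below H hf with refl ← lvl hf = below , H

    AncestorsValid-drop : ∀ {j anc} seg → All (HasFocus ∘ proj₁) seg →
                          AncestorsValid j (seg ++ anc) → AncestorsValid j anc
    AncestorsValid-drop []              []        H = H
    AncestorsValid-drop ((s , b) ∷ seg) (hf ∷ fs) H =
      AncestorsValid-mono _ (≤-raise b _) (AncestorsValid-drop seg fs (proj₂ (H hf)))

    AncestorsValid-drop-progress : ∀ {j anc} seg → All (HasFocus ∘ proj₁) seg →
                                   Any (λ e → proj₂ e ≡ true) seg →
                                   AncestorsValid j (seg ++ anc) → AncestorsValid (suc j) anc
    AncestorsValid-drop-progress ((s , true) ∷ seg) (hf ∷ fs) (here refl) H =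
      AncestorsValid-drop seg fs (proj₂ (H hf))
    AncestorsValid-drop-progress ((s , b) ∷ seg) (hf ∷ fs) (there progress) H =
      AncestorsValid-mono _ (s≤s (≤-raise b _)) (AncestorsValid-drop-progress seg fs progress (proj₂ (H hf)))

    companion-valid : ∀ {anc s j} → Companion anc s → AncestorsValid j anc → ValidAt j s
    companion-valid (seg , (c , b) , rest , refl , c≋s , hf ∷ fs , _ , progress) H =
      ValidAt-resp-≋ c≋s (below progress)
      where
        below : Any (λ e → proj₂ e ≡ true) ((c , b) ∷ seg) → ValidAt _ c
        below (here refl) = proj₁ (AncestorsValid-drop seg fs H hf) ≤-refl
        below (there progress) = proj₁ (AncestorsValid-drop-progress seg fs progress H hf) (≤-raise b _)

    Cyc-WF : ∀ {P anc t} → Cyc P anc t → WF (label t)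
    Cyc-WF (bud wf _)       = wf
    Cyc-WF (node _ wf _ _)  = wf

    module _ {P : Calculus} (cls : FrameClass P F) where
      mutual
        node-valid : ∀ {anc t} → Cyc P anc t → ∀ j → AncestorsValid j anc → ValidAt j (label t)
        node-valid (bud _ companion) _ H = companion-valid companion H
        node-valid {anc} (node i wf refl cycs) = <-rec _ λ j IH H →
          let below = λ {l} l<j → IH {l} l<j (AncestorsValid-mono anc (<⇒≤ l<j) H) in
          inst-sound cls i wf (All.map⁺ (All.map Cyc-WF cycs)) j
            (All.map⁺ (All.map (λ valid j′ lvl → valid j′ (AncestorsValid-∷ {b = focCR i} lvl below H))
                               (children-valid cycs)))

        children-valid : ∀ {anc ts} → All (Cyc P anc) ts →
                         All (λ t → ∀ j → AncestorsValid j anc → ValidAt j (label t)) ts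
        children-valid []           = []
        children-valid (cyc ∷ cycs) = node-valid cyc ∷ children-valid cycs

    ⋀-elim : ∀ Γ {w} → w ⊨ ⋀ (strip Γ) → AllHold w Γ
    ⋀-elim []            _         = []
    ⋀-elim (_ ∷ [])      h         = h ∷ []
    ⋀-elim (_ ∷ d ∷ Γ)   (h , hs)  = h ∷ ⋀-elim (d ∷ Γ) hs

    ⋁-intro : ∀ Δ {w} → AnyHolds w Δ → w ⊨ ⋁ (strip Δ)
    ⋁-intro (_ ∷ [])     (here h)  = h
    ⋁-intro (_ ∷ _ ∷ _)  (here h)  = inj₁ h
    ⋁-intro (_ ∷ d ∷ Δ)  (there h) = inj₂ (⋁-intro (d ∷ Δ) h)

    ValidAt-all⇒⊨ : ∀ {s} → WF s → (∀ k → ValidAt k s) → ∀ w → w ⊨ seqFormula s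
    ValidAt-all⇒⊨ {s} (_ , unique , _) valid _ v _ hΓ =
      ⋁-intro (succ s) (AnyHoldsAt-limit unique (λ k → valid k v (⋀-elim (ant s) hΓ)))

mainTheorem12 : ExcludedMiddle 0ℓ →
    (Atom : Set) (n : ℕ) (P : Calculus) (σ : Logic.Sequent Atom n) →
    Logic.CyclicProof Atom n P σ →
    Logic.ValidOver Atom n (Logic.FrameClass Atom n P) σ
mainTheorem12 em Atom n P σ (t , refl , cyc) F cls V mono =
  ValidAt-all⇒⊨ (Cyc-WF cyc) (λ k → node-valid cls cyc k tt)
  where
    open Soundness Atom n
    open Semantics em F V mono
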